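{- Let $s$ be a string over a finite alphabet $\Sigma$ with $|\Sigma_s| \ge 2$, and let $p,q$ be positive integers that are both parameterized periods of $s$. If $p + q + \min(p,q)\cdot(|\Sigma_s|-2) \le |s|$, then $\gcd(p,q)$ is a parameterized period of $s$.
   Context: For a string $w$, $\Sigma_w$ denotes the set of distinct characters occurring in $w$. Two strings $x,y$ of equal length $k$ are parameterized equivalent, written $x\approx y$, if there is a bijection $f:\Sigma\to\Sigma$ with $f(x[i])=y[i]$ for all $1\le i\le k$. A positive integer $p$ is a parameterized period of $s$ if $s[1..|s|-p] \approx s[p+1..|s|]$, i.e., there is a bijection $f$ of $\Sigma$ with $f(s[i]) = s[i+p]$ for all $1 \le i \le |s|-p$. (Different parameterized periods may be witnessed by different bijections.) -}

module Defs where

open import Data.Nat using (ℕ; _+_; _<_; _≤_)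
open import Data.Fin using (Fin; fromℕ<)
open import Data.Fin.Subset using (Subset; ∣_∣)
open import Data.Fin.Properties using (_≟_)
open import Data.Vec using (Vec; lookup; tabulate)
open import Data.Vec.Membership.DecPropositional using (_∈?_)
open import Data.Product using (Σ; _×_)
open import Function.Bundles using (_⤖_; Bijection)
open import Relation.Binary.PropositionalEquality using (_≡_)
open import Relation.Nullary.Decidable using (⌊_⌋)

Str : ℕ → ℕ → Set
Str k n = Vec (Fin k) n

charSet : ∀ {k n} → Str k n → Subset k
charSet s = tabulate (λ c → ⌊ _∈?_ _≟_ c s ⌋)

numChars : ∀ {k n} → Str k n → ℕ
numChars s = ∣ charSet s ∣

IsPPeriod : ∀ {k n} → Str k n → ℕ → Set
IsPPeriod {k} {n} s p =
  1 ≤ p ×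
  Σ (Fin k ⤖ Fin k) (λ f →
    (∀ i → (i<n : i < n) → (ip<n : i + p < n) →
       Bijection.to f (lookup s (fromℕ< i<n)) ≡ lookup s (fromℕ< ip<n)))

{-# OPTIONS --safe #-}

-- Euclid's algorithm on parameterized periods. Let f and g witness the periods p ≤ q = p + t
-- with p ∤ q. Then f⁻¹ ∘ g witnesses the period t of the prefix of length |s| − p, so by
-- induction that prefix has period r = gcd p t = gcd p q, witnessed by some h. The period r
-- extends to all of s once f agrees with h^(p/r) on every character of the prefix: for
-- j = i − p one then has h (s i) = h (h^(p/r) (s j)) = h^(p/r) (s (j + r)) = s (i + r).
-- Agreement is clear for characters occurring at positions j with j + p < |s| − p. The
-- character sets of the prefixes of length 0, r, 2r, … grow until some block of length r adds
-- no new character, after which periodicity with r adds none either; there are at most |Σ_s|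
-- growth steps, and the length bound leaves room for them when |Σ_s| ≥ 3. With at most two
-- characters, f and h^(p/r) are injections into a two-letter set agreeing at s[0], so they
-- agree everywhere.
module Submission where

open import Defs
open import Data.Nat using (ℕ; _+_; _*_; _∸_; _≤_; _⊓_)
open import Data.Nat.GCD using (gcd)

open import Data.Bool using (true)
open import Data.Fin as Fin using (Fin; fromℕ<)
open import Data.Fin.Properties using (_≟_; fromℕ<-cong)
open import Data.Fin.Subset using (Subset; ∣_∣; _∈_; _⊆_; ⊥; ⁅_⁆; _∪_; _-_)
open import Data.Fin.Subset.Properties
  using ( _∈?_; ∉⊥; x∈⁅x⁆; x∈⁅y⁆⇒x≡y; p⊆p∪q; q⊆p∪q; x∈p∪q⁻; x∈p∧x≢y⇒x∈p-y
        ; x∈p⇒∣p-x∣<∣p∣; p⊆q⇒∣p∣≤∣q∣; p⊂q⇒∣p∣<∣q∣ )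
open import Data.Nat using (zero; suc; _<_; z≤n; s≤s; z<s; >-nonZero)
open import Data.Nat.Properties hiding (_≟_)
open import Data.Nat.Divisibility
  using (_∣_; divides; _∣?_; ∣-refl; ∣-reflexive; ∣-antisym; ∣⇒≤; ∣m∣n⇒∣m+n)
open import Data.Nat.GCD
  using (gcd-GCD; module GCD; gcd[m,n]∣m; gcd[m,n]∣n; gcd-greatest; gcd-comm; gcd[m,n]≢0)
open import Data.Nat.Induction using (<-wellFounded)
open import Data.Nat.Tactic.RingSolver using (solve-∀)
open import Data.Product using (Σ-syntax; ∃-syntax; _×_; _,_; proj₁; proj₂)
open import Data.Sum using (_⊎_; inj₁; inj₂)
open import Data.Vec using (lookup)
open import Data.Vec.Properties using (lookup∘tabulate; lookup⇒[]=)
open import Data.Vec.Membership.Propositional renaming (_∈_ to _∈ᵥ_)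
open import Data.Vec.Membership.Propositional.Properties using (∈-lookup)
import Data.Vec.Membership.DecPropositional as VecMembership
open import Function using (_∘_)
open import Function.Bundles using (_⤖_; Bijection)
open import Function.Construct.Composition using (_⤖-∘_)
open import Function.Construct.Symmetry using (⤖-sym)
open import Function.Definitions using (Injective)
open import Induction.WellFounded using (Acc; acc)
open import Relation.Binary.PropositionalEquality
open import Relation.Nullary using (¬_; Dec; yes; no; contradiction)
open import Relation.Nullary.Decidable using (⌊_⌋)

open Bijection using (to; to⁻; injective; surjective)

private variable
  n : ℕ
  P Q : Subset n
  u v w : Fin n

p⊆q∧∣q∣≤∣p∣⇒q⊆p : P ⊆ Q → ∣ Q ∣ ≤ ∣ P ∣ → Q ⊆ P
p⊆q∧∣q∣≤∣p∣⇒q⊆p {P = P} P⊆Q ∣Q∣≤∣P∣ {u} u∈Q with u ∈? P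
... | yes u∈P = u∈P
... | no  u∉P = contradiction ∣Q∣≤∣P∣ (<⇒≱ (p⊂q⇒∣p∣<∣q∣ (P⊆Q , u , u∈Q , u∉P)))

∣p∣≤1⇒u≡v : ∣ P ∣ ≤ 1 → u ∈ P → v ∈ P → u ≡ v
∣p∣≤1⇒u≡v {P = P} {u = u} {v = v} ∣P∣≤1 u∈P v∈P with u ≟ v
... | yes u≡v = u≡v
... | no  u≢v = contradiction ∣P∣≤1 (<⇒≱ (≤-<-trans 1≤∣P-u∣ (x∈p⇒∣p-x∣<∣p∣ u∈P)))
  where
  1≤∣P-u∣ : 1 ≤ ∣ P - u ∣
  1≤∣P-u∣ = ≤-<-trans z≤n (x∈p⇒∣p-x∣<∣p∣ (x∈p∧x≢y⇒x∈p-y v∈P (u≢v ∘ sym)))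

∣p∣≤2⇒u≢w⇒v≢w⇒u≡v : ∣ P ∣ ≤ 2 → u ∈ P → v ∈ P → w ∈ P → u ≢ w → v ≢ w → u ≡ v
∣p∣≤2⇒u≢w⇒v≢w⇒u≡v ∣P∣≤2 u∈P v∈P w∈P u≢w v≢w =
  ∣p∣≤1⇒u≡v (≤-pred (≤-trans (x∈p⇒∣p-x∣<∣p∣ w∈P) ∣P∣≤2))
            (x∈p∧x≢y⇒x∈p-y u∈P u≢w) (x∈p∧x≢y⇒x∈p-y v∈P v≢w)

AgreeOn : Subset n → (Fin n → Fin n) → (Fin n → Fin n) → Set
AgreeOn P φ ψ = ∀ {u} → u ∈ P → φ u ≡ ψ u

injections-into-≤2-agree : ∀ {φ ψ : Fin n → Fin n} → ∣ P ∣ ≤ 2 →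
  Injective _≡_ _≡_ φ → Injective _≡_ _≡_ ψ → φ w ≡ ψ w →
  φ w ∈ P → φ u ∈ P → ψ u ∈ P → φ u ≡ ψ u
injections-into-≤2-agree {w = w} {u = u} ∣P∣≤2 φ-inj ψ-inj φw≡ψw φw∈P φu∈P ψu∈P with u ≟ w
... | yes refl = φw≡ψw
... | no  u≢w  = ∣p∣≤2⇒u≢w⇒v≢w⇒u≡v ∣P∣≤2 φu∈P ψu∈P φw∈P
                   (u≢w ∘ φ-inj) (u≢w ∘ ψ-inj ∘ λ ψu≡φw → trans ψu≡φw φw≡ψw)

module _ {a} {A : Set a} where
  open import Function.Endo.Propositional A using (_^_)

  ^-commute : ∀ (φ : A → A) n x → (φ ^ n) (φ x) ≡ φ ((φ ^ n) x)
  ^-commute φ zero    x = refl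
  ^-commute φ (suc n) x = cong φ (^-commute φ n x)

  ^-injective : ∀ {φ : A → A} → Injective _≡_ _≡_ φ → ∀ n → Injective _≡_ _≡_ (φ ^ n)
  ^-injective φ-inj zero    eq = eq
  ^-injective φ-inj (suc n) eq = ^-injective φ-inj n (φ-inj eq)

  ^-preserves : ∀ {ℓ} {Q : A → Set ℓ} {φ : A → A} → (∀ {x} → Q x → Q (φ x)) →
                ∀ n {x} → Q x → Q ((φ ^ n) x)
  ^-preserves                 φ-pres zero        Qx = Qx
  ^-preserves {Q = Q} {φ} φ-pres (suc n) {x} Qx =
    φ-pres {(φ ^ n) x} (^-preserves {Q = Q} {φ} φ-pres n {x} Qx)

to⁻∘to : ∀ {a b} {A : Set a} {B : Set b} (f : A ⤖ B) {x} → to⁻ f (to f x) ≡ x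
to⁻∘to f {x} = injective f (proj₂ (surjective f (to f x)) refl)

m∣n∧m≢n⇒m+m≤n : ∀ {m n} → 1 ≤ n → m ∣ n → m ≢ n → m + m ≤ n
m∣n∧m≢n⇒m+m≤n           1≤n (divides zero          refl) _   = contradiction 1≤n λ ()
m∣n∧m≢n⇒m+m≤n {m = m} _   (divides (suc zero)    refl) m≢n = contradiction (sym (+-identityʳ m)) m≢n
m∣n∧m≢n⇒m+m≤n {m = m} _   (divides (suc (suc q)) refl) _   = +-monoʳ-≤ m (m≤m+n m (q * m))

d*r≤r+p*[d∸2] : ∀ {d r p} → 3 ≤ d → r + r ≤ p → d * r ≤ r + p * (d ∸ 2)
d*r≤r+p*[d∸2] {r = r} {p} 3≤d r+r≤p with e , refl ← m≤n⇒∃[o]m+o≡n 3≤d = +-monoʳ-≤ r (begin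
  (2 + e) * r          ≤⟨ m≤m+n ((2 + e) * r) (e * r) ⟩
  (2 + e) * r + e * r  ≡⟨ regroup e r ⟩
  (r + r) * (1 + e)    ≤⟨ *-monoˡ-≤ (1 + e) r+r≤p ⟩
  p * (1 + e)          ∎)
  where
  open ≤-Reasoning
  regroup : ∀ e r → (2 + e) * r + e * r ≡ (r + r) * (1 + e)
  regroup = solve-∀

m∣n⇒gcd[m,n]≡m : ∀ {m n} → m ∣ n → gcd m n ≡ m
m∣n⇒gcd[m,n]≡m {m} {n} m∣n = ∣-antisym (gcd[m,n]∣m m n) (gcd-greatest ∣-refl m∣n)

gcd[m,n]≡gcd[m,m+n] : ∀ m n → gcd m n ≡ gcd m (m + n)
gcd[m,n]≡gcd[m,m+n] m n = GCD.unique (GCD.step (gcd-GCD m n)) (gcd-GCD m (m + n))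

m∤m+n⇒2gcd[m,n]≤m : ∀ {m n} → 1 ≤ m → ¬ m ∣ m + n → gcd m n + gcd m n ≤ m
m∤m+n⇒2gcd[m,n]≤m {m} {n} 1≤m m∤m+n = m∣n∧m≢n⇒m+m≤n 1≤m (gcd[m,n]∣m m n)
  (λ gcd≡m → m∤m+n (∣m∣n⇒∣m+n ∣-refl (subst (_∣ n) gcd≡m (gcd[m,n]∣n m n))))

module Periodicity {k : ℕ} (s : ℕ → Fin k) where
  open import Function.Endo.Propositional (Fin k) using (_^_)

  private variable
    m M p q r t x : ℕ
    φ ψ χ : Fin k → Fin k

  chars : ℕ → Subset k
  chars zero    = ⊥
  chars (suc x) = chars x ∪ ⁅ s x ⁆

  ∈chars⁺ : ∀ {i} → i < x → s i ∈ chars x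
  ∈chars⁺ {x = suc x} i<1+x with m<1+n⇒m<n∨m≡n i<1+x
  ... | inj₁ i<x  = p⊆p∪q ⁅ s x ⁆ (∈chars⁺ i<x)
  ... | inj₂ refl = q⊆p∪q (chars x) ⁅ s x ⁆ (x∈⁅x⁆ (s x))

  ∈chars⁻ : ∀ {c} → c ∈ chars x → ∃[ i ] i < x × s i ≡ c
  ∈chars⁻ {x = zero}  c∈⊥ = contradiction c∈⊥ ∉⊥
  ∈chars⁻ {x = suc x} c∈  with x∈p∪q⁻ (chars x) ⁅ s x ⁆ c∈
  ... | inj₂ c∈⁅sx⁆ = x , ≤-refl , sym (x∈⁅y⁆⇒x≡y (s x) c∈⁅sx⁆)
  ... | inj₁ c∈chars with i , i<x , si≡c ← ∈chars⁻ c∈chars = i , m<n⇒m<1+n i<x , si≡c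

  chars-mono : x ≤ m → chars x ⊆ chars m
  chars-mono x≤m c∈ with i , i<x , refl ← ∈chars⁻ c∈ = ∈chars⁺ (<-≤-trans i<x x≤m)

  record Periodic (m p : ℕ) (φ : Fin k → Fin k) : Set where
    field shift : ∀ i → i + p < m → φ (s i) ≡ s (i + p)
  open Periodic public

  HasPeriod : ℕ → ℕ → Set
  HasPeriod m p = Σ[ f ∈ Fin k ⤖ Fin k ] Periodic m p (to f)

  Periodic-≤ : M ≤ m → Periodic m p φ → Periodic M p φ
  shift (Periodic-≤ M≤m φp) i i+p<M = shift φp i (<-≤-trans i+p<M M≤m)

  Periodic-^ : Periodic m r φ → ∀ a i → i + a * r < m → (φ ^ a) (s i) ≡ s (i + a * r)
  Periodic-^                 φp zero    i _  = cong s (sym (+-identityʳ i))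
  Periodic-^ {m} {r} {φ} φp (suc a) i lt = begin
    φ ((φ ^ a) (s i))    ≡⟨ cong φ (Periodic-^ φp a i (≤-<-trans (m≤m+n _ r) i+ar+r<m)) ⟩
    φ (s (i + a * r))    ≡⟨ shift φp (i + a * r) i+ar+r<m ⟩
    s (i + a * r + r)    ≡⟨ cong s reassoc ⟩
    s (i + (r + a * r))  ∎
    where
    open ≡-Reasoning
    reassoc : i + a * r + r ≡ i + (r + a * r)
    reassoc = trans (+-assoc i (a * r) r) (cong (i +_) (+-comm (a * r) r))
    i+ar+r<m : i + a * r + r < m
    i+ar+r<m = subst (_< m) (sym reassoc) lt

  Periodic-∈chars : Periodic m p φ → x + p ≤ m → ∀ {c} → c ∈ chars x → φ c ∈ chars (x + p)
  Periodic-∈chars {p = p} {x = x} φp x+p≤m c∈ with i , i<x , refl ← ∈chars⁻ c∈ =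
    let i+p<x+p = +-monoˡ-< p i<x
    in subst (_∈ chars (x + p)) (sym (shift φp i (<-≤-trans i+p<x+p x+p≤m))) (∈chars⁺ i+p<x+p)

  Periodic-difference : ∀ {f g : Fin k ⤖ Fin k} → M + p ≡ m →
    Periodic m p (to f) → Periodic m (p + t) (to g) → Periodic M t (to (⤖-sym f ⤖-∘ g))
  shift (Periodic-difference {M} {p} {m} {t} {f} {g} M+p≡m fp gp) i i+t<M = begin
    to⁻ f (to g (s i))        ≡⟨ cong (to⁻ f) (shift gp i (subst (_< m) (sym reassoc) i+t+p<m)) ⟩
    to⁻ f (s (i + (p + t)))   ≡⟨ cong (to⁻ f ∘ s) reassoc ⟩
    to⁻ f (s (i + t + p))     ≡⟨ cong (to⁻ f) (shift fp (i + t) i+t+p<m) ⟨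
    to⁻ f (to f (s (i + t)))  ≡⟨ to⁻∘to f ⟩
    s (i + t)                 ∎
    where
    open ≡-Reasoning
    reassoc : i + (p + t) ≡ i + t + p
    reassoc = trans (cong (i +_) (+-comm p t)) (sym (+-assoc i t p))
    i+t+p<m : i + t + p < m
    i+t+p<m = subst (i + t + p <_) M+p≡m (+-monoˡ-< p i+t<M)

  Stable : ℕ → ℕ → Set
  Stable r x = chars (x + r) ⊆ chars x

  Stable⇒chars⊆ : 1 ≤ r → Periodic m r φ → x + r ≤ m → Stable r x → chars m ⊆ chars x
  Stable⇒chars⊆ {r} {m} {φ} {x} 1≤r φp x+r≤m stable =
    subst (λ y → chars y ⊆ chars x) (m∸n+n≡m x+r≤m)
      (covers (m ∸ (x + r)) (≤-reflexive (m∸n+n≡m x+r≤m)))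
    where
    covers : ∀ n → n + (x + r) ≤ m → chars (n + (x + r)) ⊆ chars x
    covers zero    _  = stable
    covers (suc n) le c∈ with x∈p∪q⁻ (chars (n + (x + r))) ⁅ s (n + (x + r)) ⁆ c∈
    ... | inj₁ c∈old = covers n (<⇒≤ le) c∈old
    ... | inj₂ c∈new = subst (_∈ chars x) (sym (x∈⁅y⁆⇒x≡y _ c∈new)) new∈chars
      where
      n+x+r<m : n + x + r < m
      n+x+r<m = subst (_< m) (sym (+-assoc n x r)) le
      old∈chars : s (n + x) ∈ chars x
      old∈chars = covers n (<⇒≤ le) (∈chars⁺ (+-monoʳ-< n (m<m+n x 1≤r)))
      new∈chars : s (n + (x + r)) ∈ chars x
      new∈chars = subst (_∈ chars x) (trans (shift φp (n + x) n+x+r<m) (cong s (+-assoc n x r)))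
                        (stable (Periodic-∈chars φp x+r≤m old∈chars))

  stable-or-growing : ∀ r j → (∃[ i ] i < j × Stable r (i * r)) ⊎ j ≤ ∣ chars (j * r) ∣
  stable-or-growing r zero = inj₂ z≤n
  stable-or-growing r (suc j) with stable-or-growing r j
  ... | inj₁ (i , i<j , stable) = inj₁ (i , m<n⇒m<1+n i<j , stable)
  ... | inj₂ j≤∣jr∣ with ∣ chars (j * r + r) ∣ ≤? ∣ chars (j * r) ∣
  ...   | yes no-growth =
    inj₁ (j , ≤-refl , p⊆q∧∣q∣≤∣p∣⇒q⊆p (chars-mono (m≤m+n (j * r) r)) no-growth)
  ...   | no  growth    =
    inj₂ (subst (λ y → suc j ≤ ∣ chars y ∣) (+-comm (j * r) r) (≤-trans (s≤s j≤∣jr∣) (≰⇒> growth)))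

  agree-on-prefix : ∀ a → Periodic m p φ → Periodic m r ψ → p ≡ a * r → x + p ≤ m →
                    AgreeOn (chars x) φ (ψ ^ a)
  agree-on-prefix {r = r} a φp ψp refl x+p≤m c∈ with i , i<x , refl ← ∈chars⁻ c∈ =
    let i+p<m = <-≤-trans (+-monoˡ-< (a * r) i<x) x+p≤m
    in trans (shift φp i i+p<m) (sym (Periodic-^ ψp a i i+p<m))

  extend-by-agreement : M + p ≡ m → r + p ≤ M → Periodic m p φ → Periodic M r ψ →
                        AgreeOn (chars M) φ χ → (∀ c → χ (ψ c) ≡ ψ (χ c)) → Periodic m r ψ
  shift (extend-by-agreement {M} {p} {m} {r} {φ} {ψ} {χ} M+p≡m r+p≤M φp ψp agree commute) i i+r<m
    with i + r <? M
  ... | yes i+r<M = shift ψp i i+r<M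
  ... | no  i+r≮M = begin
    ψ (s i)        ≡⟨ cong (ψ ∘ s) j+p≡i ⟨
    ψ (s (j + p))  ≡⟨ cong ψ (shift φp j j+p<m) ⟨
    ψ (φ (s j))    ≡⟨ cong ψ (agree (∈chars⁺ j<M)) ⟩
    ψ (χ (s j))    ≡⟨ commute (s j) ⟨
    χ (ψ (s j))    ≡⟨ cong χ (shift ψp j j+r<M) ⟩
    χ (s (j + r))  ≡⟨ agree (∈chars⁺ j+r<M) ⟨
    φ (s (j + r))  ≡⟨ shift φp (j + r) j+r+p<m ⟩
    s (j + r + p)  ≡⟨ cong s j+r+p≡i+r ⟩
    s (i + r)      ∎
    where
    open ≡-Reasoning
    p≤i : p ≤ i
    p≤i = +-cancelʳ-≤ r p i (≤-trans (subst (_≤ M) (+-comm r p) r+p≤M) (≮⇒≥ i+r≮M))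
    j : ℕ
    j = i ∸ p
    j+p≡i : j + p ≡ i
    j+p≡i = m∸n+n≡m p≤i
    j+r+p≡i+r : j + r + p ≡ i + r
    j+r+p≡i+r = trans (+-assoc j r p) (trans (cong (j +_) (+-comm r p))
                  (trans (sym (+-assoc j p r)) (cong (_+ r) j+p≡i)))
    j+r+p<m : j + r + p < m
    j+r+p<m = subst (_< m) (sym j+r+p≡i+r) i+r<m
    j+r<M : j + r < M
    j+r<M = +-cancelʳ-< p (j + r) M (subst (j + r + p <_) (sym M+p≡m) j+r+p<m)
    j<M : j < M
    j<M = ≤-<-trans (m≤m+n j r) j+r<M
    j+p<m : j + p < m
    j+p<m = subst (_< m) (sym j+p≡i) (≤-<-trans (m≤m+n i r) i+r<m)

  agree-from-stable : ∀ a → 1 ≤ r → r ≤ p → Periodic M p φ → Periodic M r ψ → p ≡ a * r →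
                      x + p ≤ M → Stable r x → AgreeOn (chars M) φ (ψ ^ a)
  agree-from-stable a 1≤r r≤p φp ψp p≡ar x+p≤M stable c∈ =
    agree-on-prefix a φp ψp p≡ar x+p≤M
      (Stable⇒chars⊆ 1≤r ψp (≤-trans (+-monoʳ-≤ _ r≤p) x+p≤M) stable c∈)

  agree-with-room : ∀ a → 1 ≤ r → r ≤ p → ∣ chars M ∣ * r + p ≤ M →
                    Periodic M p φ → Periodic M r ψ → p ≡ a * r → AgreeOn (chars M) φ (ψ ^ a)
  agree-with-room {r} {p} {M} a 1≤r r≤p room φp ψp p≡ar with stable-or-growing r (suc ∣ chars M ∣)
  ... | inj₁ (i , i≤d , stable) = agree-from-stable a 1≤r r≤p φp ψp p≡ar i*r+p≤M stable
    where
    i*r+p≤M : i * r + p ≤ M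
    i*r+p≤M = ≤-trans (+-monoˡ-≤ p (*-monoˡ-≤ r (≤-pred i≤d))) room
  ... | inj₂ growth = contradiction (≤-trans growth (p⊆q⇒∣p∣≤∣q∣ (chars-mono r+dr≤M))) 1+n≰n
    where
    r+dr≤M : r + ∣ chars M ∣ * r ≤ M
    r+dr≤M = ≤-trans (≤-trans (≤-reflexive (+-comm r _)) (+-monoʳ-≤ _ r≤p)) room

  agree-two-chars : ∀ {f h : Fin k ⤖ Fin k} a → M + p ≡ m → p < M → x + r ≤ M →
                    chars m ⊆ chars x → ∣ chars m ∣ ≤ 2 →
                    Periodic m p (to f) → Periodic M r (to h) → p ≡ a * r →
                    AgreeOn (chars M) (to f) (to h ^ a)
  agree-two-chars {M} {p} {m} {x} {r} {f} {h} a M+p≡m p<M x+r≤M all-early ∣m∣≤2 fp hp p≡ar c∈ =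
    injections-into-≤2-agree ∣m∣≤2 (injective f) (^-injective (injective h) a) agree₀
      (f-into (∈chars⁺ (≤-<-trans z≤n p<M))) (f-into c∈)
      (^-preserves {Q = _∈ chars m} h-into a (chars-mono M≤m c∈))
    where
    M≤m : M ≤ m
    M≤m = subst (M ≤_) M+p≡m (m≤m+n M p)
    h-into : ∀ {c} → c ∈ chars m → to h c ∈ chars m
    h-into c∈ = chars-mono (≤-trans x+r≤M M≤m) (Periodic-∈chars hp x+r≤M (all-early c∈))
    f-into : ∀ {c} → c ∈ chars M → to f c ∈ chars m
    f-into c∈ = subst (λ y → to f _ ∈ chars y) M+p≡m (Periodic-∈chars fp (≤-reflexive M+p≡m) c∈)
    agree₀ : to f (s 0) ≡ (to h ^ a) (s 0)
    agree₀ = agree-on-prefix a (Periodic-≤ M≤m fp) hp p≡ar p<M (∈chars⁺ {x = 1} z<s)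

  extend-divisor-period : ∀ {f h : Fin k ⤖ Fin k} → M + p ≡ m → 1 ≤ r → r ∣ p → r + r ≤ p →
                          p + r + p * (∣ chars m ∣ ∸ 2) ≤ M →
                          Periodic m p (to f) → Periodic M r (to h) → Periodic m r (to h)
  extend-divisor-period {M} {p} {m} {r} {f} {h} M+p≡m 1≤r (divides a p≡ar) r+r≤p bound fp hp =
    extend-by-agreement M+p≡m r+p≤M fp hp agree (^-commute (to h) a)
    where
    M≤m : M ≤ m
    M≤m = subst (M ≤_) M+p≡m (m≤m+n M p)
    r≤p : r ≤ p
    r≤p = m+n≤o⇒n≤o r r+r≤p
    r+p≤M : r + p ≤ M
    r+p≤M = subst (_≤ M) (+-comm p r) (m+n≤o⇒m≤o (p + r) bound)
    fpM : Periodic M p (to f)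
    fpM = Periodic-≤ M≤m fp
    agree : AgreeOn (chars M) (to f) (to h ^ a)
    agree with ∣ chars m ∣ ≤? 2 | stable-or-growing r 2
    ... | no d≰2 | _ = agree-with-room a 1≤r r≤p room fpM hp p≡ar
      where
      d : ℕ
      d = ∣ chars m ∣
      room : ∣ chars M ∣ * r + p ≤ M
      room = begin
        ∣ chars M ∣ * r + p      ≤⟨ +-monoˡ-≤ p (*-monoˡ-≤ r (p⊆q⇒∣p∣≤∣q∣ (chars-mono M≤m))) ⟩
        d * r + p                ≤⟨ +-monoˡ-≤ p (d*r≤r+p*[d∸2] (≰⇒> d≰2) r+r≤p) ⟩
        r + p * (d ∸ 2) + p      ≡⟨ rearrange p r (p * (d ∸ 2)) ⟩
        p + r + p * (d ∸ 2)      ≤⟨ bound ⟩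
        M                        ∎
        where
        open ≤-Reasoning
        rearrange : ∀ p r x → r + x + p ≡ p + r + x
        rearrange = solve-∀
    ... | yes _ | inj₁ (i , i<2 , stable) = agree-from-stable a 1≤r r≤p fpM hp p≡ar i*r+p≤M stable
      where
      i*r+p≤M : i * r + p ≤ M
      i*r+p≤M = ≤-trans (+-monoˡ-≤ p (≤-trans (*-monoˡ-≤ r (≤-pred i<2)) (≤-reflexive (+-identityʳ r))))
                        r+p≤M
    ... | yes d≤2 | inj₂ 2≤∣2r∣ =
      agree-two-chars {f = f} {h = h} a M+p≡m p<M 2r+r≤M all-early d≤2 fp hp p≡ar
      where
      p<M : p < M
      p<M = ≤-trans (+-monoˡ-≤ p 1≤r) r+p≤M
      2r+r≤M : 2 * r + r ≤ M
      2r+r≤M = ≤-trans (+-monoˡ-≤ r (subst (_≤ p) (cong (r +_) (sym (+-identityʳ r))) r+r≤p))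
                 (subst (_≤ M) (+-comm r p) r+p≤M)
      all-early : chars m ⊆ chars (2 * r)
      all-early = p⊆q∧∣q∣≤∣p∣⇒q⊆p (chars-mono (≤-trans (m≤m+n (2 * r) r) (≤-trans 2r+r≤M M≤m)))
                                  (≤-trans d≤2 2≤∣2r∣)

  LengthBound : ℕ → ℕ → ℕ → Set
  LengthBound m p q = p + q + (p ⊓ q) * (∣ chars m ∣ ∸ 2) ≤ m

  LengthBound-comm : LengthBound m p q → LengthBound m q p
  LengthBound-comm {m} {p} {q} =
    subst (_≤ m) (cong₂ (λ y z → y + z * (∣ chars m ∣ ∸ 2)) (+-comm p q) (⊓-comm p q))

  LengthBound⇒prefix-bound : LengthBound m p (p + t) → p + t + p * (∣ chars m ∣ ∸ 2) ≤ m ∸ p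
  LengthBound⇒prefix-bound {m} {p} {t} bound =
    m+n≤o⇒m≤o∸n (p + t + p * (d ∸ 2)) (subst (_≤ m) (rearrange p t (p * (d ∸ 2)))
      (subst (λ y → p + (p + t) + y * (d ∸ 2) ≤ m) (m≤n⇒m⊓n≡m (m≤m+n p t)) bound))
    where
    d : ℕ
    d = ∣ chars m ∣
    rearrange : ∀ p t x → p + (p + t) + x ≡ p + t + x + p
    rearrange = solve-∀

  gcd-period-step : 1 ≤ p → HasPeriod m p → HasPeriod m (p + t) → LengthBound m p (p + t) →
    (∀ {M} → 1 ≤ t → HasPeriod M p → HasPeriod M t → LengthBound M p t → HasPeriod M (gcd p t)) →
    HasPeriod m (gcd p (p + t))
  gcd-period-step {p} {m} {t} 1≤p (f , fp) (g , gp) bound prefix-period with p ∣? p + t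
  ... | yes p∣p+t = f , subst (λ e → Periodic m e (to f)) (sym (m∣n⇒gcd[m,n]≡m p∣p+t)) fp
  ... | no  p∤p+t =
    let h , hp = prefix-period 1≤t (f , Periodic-≤ m∸p≤m fp)
                   (⤖-sym f ⤖-∘ g , Periodic-difference {f = f} {g = g} m∸p+p≡m fp gp) prefix-bound
    in h , subst (λ e → Periodic m e (to h)) (gcd[m,n]≡gcd[m,m+n] p t)
             (extend-divisor-period {f = f} {h = h} m∸p+p≡m 1≤r (gcd[m,n]∣m p t)
                (m∤m+n⇒2gcd[m,n]≤m 1≤p p∤p+t) extension-bound fp hp)
    where
    d : ℕ
    d = ∣ chars m ∣
    m∸p+p≡m : m ∸ p + p ≡ m
    m∸p+p≡m = m∸n+n≡m (m+n≤o⇒m≤o p (m+n≤o⇒m≤o (p + (p + t)) bound))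
    m∸p≤m : m ∸ p ≤ m
    m∸p≤m = m∸n≤m m p
    bound′ : p + t + p * (d ∸ 2) ≤ m ∸ p
    bound′ = LengthBound⇒prefix-bound {p = p} {t = t} bound
    prefix-bound : LengthBound (m ∸ p) p t
    prefix-bound = ≤-trans (+-monoʳ-≤ (p + t) (*-mono-≤ (m⊓n≤m p t)
                     (∸-monoˡ-≤ 2 (p⊆q⇒∣p∣≤∣q∣ (chars-mono m∸p≤m))))) bound′
    1≤t : 1 ≤ t
    1≤t = n≢0⇒n>0 λ { refl → p∤p+t (∣-reflexive (sym (+-identityʳ p))) }
    1≤r : 1 ≤ gcd p t
    1≤r = n≢0⇒n>0 (gcd[m,n]≢0 p t (inj₁ (n>0⇒n≢0 1≤p)))
    extension-bound : p + gcd p t + p * (d ∸ 2) ≤ m ∸ p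
    extension-bound =
      ≤-trans (+-monoˡ-≤ (p * (d ∸ 2)) (+-monoʳ-≤ p (∣⇒≤ {{>-nonZero 1≤t}} (gcd[m,n]∣n p t)))) bound′

  gcd-period : Acc _<_ (p + q) → 1 ≤ p → 1 ≤ q → HasPeriod m p → HasPeriod m q →
               LengthBound m p q → HasPeriod m (gcd p q)
  gcd-period {p} {q} {m} (acc smaller) 1≤p 1≤q fp gq bound with ≤-total p q
  ... | inj₁ p≤q with t , refl ← m≤n⇒∃[o]m+o≡n p≤q =
    gcd-period-step 1≤p fp gq bound
      (λ {M} → gcd-period {m = M} (smaller (m<n+m (p + t) 1≤p)) 1≤p)
  ... | inj₂ q≤p with t , refl ← m≤n⇒∃[o]m+o≡n q≤p =
    subst (HasPeriod m) (gcd-comm q (q + t))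
      (gcd-period-step 1≤q gq fp (LengthBound-comm {p = q + t} bound)
         (λ {M} → gcd-period {m = M} (smaller (m<m+n (q + t) 1≤q)) 1≤q))

-- Positions past the end read an arbitrary character; only positions below |s| are ever used.
total : ∀ {k n} → Str k (suc n) → ℕ → Fin k
total {n = n} v i with i <? suc n
... | yes i<1+n = lookup v (fromℕ< i<1+n)
... | no  _     = lookup v Fin.zero

module _ {k n : ℕ} (v : Str k (suc n)) where
  open Periodicity (total v)

  total-lookup : ∀ {i} (i<1+n : i < suc n) → total v i ≡ lookup v (fromℕ< i<1+n)
  total-lookup {i} i<1+n with i <? suc n
  ... | yes i<1+n′ = cong (lookup v) (fromℕ<-cong i i refl i<1+n′ i<1+n)
  ... | no  i≮1+n  = contradiction i<1+n i≮1+n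

  chars⊆charSet : chars (suc n) ⊆ charSet v
  chars⊆charSet {c} c∈ with i , i<1+n , refl ← ∈chars⁻ c∈ =
    lookup⇒[]= c (charSet v) (trans (lookup∘tabulate _ c) (occurs (VecMembership._∈?_ _≟_ c v)))
    where
    c∈v : c ∈ᵥ v
    c∈v = subst (_∈ᵥ v) (sym (total-lookup i<1+n)) (∈-lookup (fromℕ< i<1+n) v)
    occurs : (c∈?v : Dec (c ∈ᵥ v)) → ⌊ c∈?v ⌋ ≡ true
    occurs (yes _)   = refl
    occurs (no  c∉v) = contradiction c∈v c∉v

  IsPPeriod⇒HasPeriod : ∀ {p} → IsPPeriod v p → HasPeriod (suc n) p
  IsPPeriod⇒HasPeriod {p} (_ , f , fp) = f , record { shift = λ i i+p<1+n →
    let i<1+n = ≤-<-trans (m≤m+n i p) i+p<1+n in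
    trans (cong (to f) (total-lookup i<1+n))
          (trans (fp i i<1+n i+p<1+n) (sym (total-lookup i+p<1+n))) }

  HasPeriod⇒IsPPeriod : ∀ {p} → 1 ≤ p → HasPeriod (suc n) p → IsPPeriod v p
  HasPeriod⇒IsPPeriod {p} 1≤p (f , fp) = 1≤p , f , λ i i<1+n i+p<1+n →
    trans (cong (to f) (sym (total-lookup i<1+n)))
          (trans (shift fp i i+p<1+n) (total-lookup i+p<1+n))

lemma11 : ∀ {k n} (s : Str k n) (p q : ℕ) →
    2 ≤ numChars s →
    IsPPeriod s p →
    IsPPeriod s q →
    p + q + (p ⊓ q) * (numChars s ∸ 2) ≤ n →
    IsPPeriod s (gcd p q)
lemma11 {n = zero}  s p q _ (1≤p , _) _ bound =
  contradiction (m+n≤o⇒m≤o p (m+n≤o⇒m≤o (p + q) bound)) (<⇒≱ 1≤p)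
lemma11 {n = suc n} s p q _ p-period q-period bound =
  HasPeriod⇒IsPPeriod s 1≤gcd
    (gcd-period (<-wellFounded (p + q)) (proj₁ p-period) (proj₁ q-period)
                (IsPPeriod⇒HasPeriod s p-period) (IsPPeriod⇒HasPeriod s q-period) bound′)
  where
  open Periodicity (total s)
  bound′ : LengthBound (suc n) p q
  bound′ = ≤-trans (+-monoʳ-≤ (p + q) (*-monoʳ-≤ (p ⊓ q) (∸-monoˡ-≤ 2 (p⊆q⇒∣p∣≤∣q∣ (chars⊆charSet s)))))
                   bound
  1≤gcd : 1 ≤ gcd p q
  1≤gcd = n≢0⇒n>0 (gcd[m,n]≢0 p q (inj₁ (n>0⇒n≢0 (proj₁ p-period))))
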